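{- Let $\mathbf A$ be a finite totally ordered algebra. Then $\mathrm{nuP}_{\mathbf A}\subseteq\textsc{MULTIMONOTONE}$.
   Context: $\mathbf A$ is totally ordered if there is a total order on $A$ preserved by all polynomial operations of $\mathbf A$. $\mathrm{nuP}_{\mathbf A}$ is the class of languages over $\{0,1\}$ recognized by NuDFAs $((t_n),\iota,S)$ with $t_n$ $n$-input circuits over $\mathbf A$ (DAGs with sources labelled by variables or constants of $A$ and gates labelled by basic operations) of size polynomial in $n$, $\iota:\{0,1\}\to A$, $S\subseteq A$, accepting $b\in\{0,1\}^n$ iff $t_n(\iota(b_1),\dots,\iota(b_n))\in S$. $\textsc{MULTIMONOTONE}$ is the class of languages recognized by polynomial-size circuit families of the form $g(C_1,\dots,C_c)$, where $c$ is a constant, $g$ is a $c$-ary Boolean function and each $C_i$ is a monotone Boolean circuit (only $\wedge,\vee$ gates). -}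

module Defs where

open import Data.Nat using (ℕ; zero; suc; _*_; _^_; _≤_)
open import Data.Fin using (Fin)
open import Data.Bool using (Bool; true; false; _∧_; _∨_)
open import Data.Vec using (Vec; []; _∷_; _∷ʳ_; lookup; last; map; tabulate)
open import Data.Vec.Relation.Binary.Pointwise.Inductive using (Pointwise)
open import Data.Product using (Σ; _×_; ∃-syntax)
open import Relation.Binary.Core using (Rel)
open import Relation.Binary.Structures using (IsTotalOrder)
open import Relation.Binary.PropositionalEquality using (_≡_)
open import Level using (0ℓ)

record FinAlgebra : Set where
  field
    k  : ℕ
    m  : ℕ
    ar : Fin m → ℕ
    op : (i : Fin m) → Vec (Fin k) (ar i) → Fin k

  Carrier : Set
  Carrier = Fin k

Lang : Set
Lang = (n : ℕ) → Vec Bool n → Bool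

PolyBounded : (ℕ → ℕ) → Set
PolyBounded f = ∃[ c ] ∃[ d ] (∀ n → f n ≤ c * (suc n) ^ d)

module _ (𝔸 : FinAlgebra) where
  open FinAlgebra 𝔸

  -- Polynomial operations: terms built from variables, constants of A
  -- and basic operations.

  data Term (n : ℕ) : Set where
    var   : Fin n → Term n
    const : Carrier → Term n
    app   : (i : Fin m) → Vec (Term n) (ar i) → Term n

  mutual
    evalT : ∀ {n} → Term n → Vec Carrier n → Carrier
    evalT (var j)    x = lookup x j
    evalT (const a)  x = a
    evalT (app i ts) x = op i (evalTs ts x)

    evalTs : ∀ {n l} → Vec (Term n) l → Vec Carrier n → Vec Carrier l
    evalTs []       x = []
    evalTs (t ∷ ts) x = evalT t x ∷ evalTs ts x

  PreservedByPolynomials : Rel Carrier 0ℓ → Set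
  PreservedByPolynomials R =
    ∀ n (t : Term n) (x y : Vec Carrier n) →
      Pointwise R x y → R (evalT t x) (evalT t y)

  TotallyOrdered : Set₁
  TotallyOrdered = Σ (Rel Carrier 0ℓ) λ R →
    IsTotalOrder _≡_ R × PreservedByPolynomials R

  -- Circuits over A, as topologically sorted DAGs (straight-line
  -- programs).

  data Node (n s : ℕ) : Set where
    input : Fin n → Node n s
    cnst  : Carrier → Node n s
    gate  : (i : Fin m) → Vec (Fin s) (ar i) → Node n s

  data Circ (n : ℕ) : ℕ → Set where
    []  : Circ n zero
    _▷_ : ∀ {s} → Circ n s → Node n s → Circ n (suc s)

  evalNode : ∀ {n s} → Node n s → Vec Carrier s → Vec Carrier n → Carrier
  evalNode (input j)   v x = lookup x j
  evalNode (cnst a)    v x = a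
  evalNode (gate i as) v x = op i (map (lookup v) as)

  evalCirc : ∀ {n s} → Circ n s → Vec Carrier n → Vec Carrier s
  evalCirc []       x = []
  evalCirc (c ▷ nd) x = let v = evalCirc c x in v ∷ʳ evalNode nd v x

  output : ∀ {n s} → Circ n (suc s) → Vec Carrier n → Carrier
  output c x = last (evalCirc c x)

  record NuDFA : Set where
    field
      size : ℕ → ℕ
      t    : (n : ℕ) → Circ n (suc (size n))
      ι    : Bool → Carrier
      S    : Carrier → Bool
      poly : PolyBounded size

    accepts : ∀ {n} → Vec Bool n → Bool
    accepts {n} b = S (output (t n) (map ι b))

  nuP : Lang → Set
  nuP L = Σ NuDFA λ D → ∀ n (b : Vec Bool n) → L n b ≡ NuDFA.accepts D b

data MNode (n s : ℕ) : Set where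
  mvar   : Fin n → MNode n s
  mconst : Bool → MNode n s
  and    : Fin s → Fin s → MNode n s
  or     : Fin s → Fin s → MNode n s

data MCirc (n : ℕ) : ℕ → Set where
  []  : MCirc n zero
  _▷_ : ∀ {s} → MCirc n s → MNode n s → MCirc n (suc s)

evalMNode : ∀ {n s} → MNode n s → Vec Bool s → Vec Bool n → Bool
evalMNode (mvar j)   v x = lookup x j
evalMNode (mconst b) v x = b
evalMNode (and p q)  v x = lookup v p ∧ lookup v q
evalMNode (or p q)   v x = lookup v p ∨ lookup v q

evalMCirc : ∀ {n s} → MCirc n s → Vec Bool n → Vec Bool s
evalMCirc []       x = []
evalMCirc (c ▷ nd) x = let v = evalMCirc c x in v ∷ʳ evalMNode nd v x

moutput : ∀ {n s} → MCirc n (suc s) → Vec Bool n → Bool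
moutput c x = last (evalMCirc c x)

MULTIMONOTONE : Lang → Set
MULTIMONOTONE L =
  ∃[ c ] Σ (Vec Bool c → Bool) λ g →
  Σ (Fin c → ℕ → ℕ) λ size →
  Σ ((i : Fin c) (n : ℕ) → MCirc n (suc (size i n))) λ C →
    (∀ i → PolyBounded (size i)) ×
    (∀ n (b : Vec Bool n) → L n b ≡ g (tabulate λ i → moutput (C i n) b))

module Submission where

-- Orient the total order ≼ preserved by the polynomial operations so that ι 0 ≼ ι 1. An element
-- x is determined by its threshold bits [a ≼ x], a ∈ A, and every threshold bit of a node of the
-- circuit is a monotone function of the input bits and of the threshold bits of the node's
-- arguments: for a basic operation f, which is monotone,
--   [a ≼ f(x₁,…,x_r)] = ⋁_{c₁,…,c_r} [c₁ ≼ x₁] ∧ … ∧ [c_r ≼ x_r] ∧ [a ≼ f(c₁,…,c_r)],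
-- a constant-size formula. Replacing every node by its |A| threshold bits therefore yields |A|
-- monotone circuits of polynomial size computing the threshold bits of the output, and the
-- Boolean function g decodes these bits into the output value and applies the accepting set.

open import Defs
open import Data.Bool using (Bool; true; false; _∧_; _∨_)
import Data.Bool as Bool
open import Data.Bool.Properties using (∧-conicalˡ; ∧-conicalʳ; ∨-zeroʳ; ∧-zeroʳ; ∧-identityʳ; ∨-identityʳ; ∨-idem; ¬-not)
open import Data.Empty using (⊥-elim)
open import Data.Fin using (Fin; zero; suc; inject₁; fromℕ; _≟_)
open import Data.Fin.Properties using (any?)
import Data.List as List
open import Data.List.Extrema.Nat using (max; v≤max⁺; ⊥≤max)
open import Data.List.Membership.Propositional.Properties using (∈-map⁺; ∈-allFin)
import Data.List.Relation.Unary.Any as Any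
open import Data.Nat using (ℕ; zero; suc; _+_; _*_; _^_; _≤_; z≤n; s≤s)
open import Data.Nat.Properties
  using (+-identityʳ; +-comm; +-assoc; +-suc; *-comm; *-assoc; ≤-reflexive; ≤-trans; m≤m+n;
         +-monoˡ-≤; +-monoʳ-≤; *-monoˡ-≤; m^n>0; module ≤-Reasoning)
open import Data.Product using (Σ; ∃-syntax; _×_; _,_)
open import Data.Sum using (inj₁; inj₂)
open import Data.Vec using (Vec; []; _∷_; _∷ʳ_; lookup; last; map; tabulate; allFin)
open import Data.Vec.Properties using (lookup-map; lookup∘tabulate; tabulate-cong; map-lookup-allFin; last-∷ʳ; ≡-dec)
open import Data.Vec.Relation.Binary.Pointwise.Inductive as Pointwise using (Pointwise; []; _∷_)
open import Function using (_∘_; id; flip)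
open import Level using (0ℓ)
open import Relation.Binary.Consequences using (total∧dec⇒dec)
import Relation.Binary.Construct.Flip.EqAndOrd as Flip
open import Relation.Binary.Core using (Rel; REL)
open import Relation.Binary.Definitions using (Decidable)
open import Relation.Binary.Structures using (IsTotalOrder)
open import Relation.Binary.PropositionalEquality
open import Relation.Nullary.Decidable using (yes; no; does; dec-true)

lookup-∷ʳ-inject₁ : ∀ {A : Set} {s} (v : Vec A s) (x : A) (i : Fin s) →
                    lookup (v ∷ʳ x) (inject₁ i) ≡ lookup v i
lookup-∷ʳ-inject₁ (y ∷ v) x zero    = refl
lookup-∷ʳ-inject₁ (y ∷ v) x (suc i) = lookup-∷ʳ-inject₁ v x i

lookup-∷ʳ-fromℕ : ∀ {A : Set} {s} (v : Vec A s) (x : A) → lookup (v ∷ʳ x) (fromℕ s) ≡ x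
lookup-∷ʳ-fromℕ []      x = refl
lookup-∷ʳ-fromℕ (y ∷ v) x = lookup-∷ʳ-fromℕ v x

module _ {A B : Set} {P : REL A B 0ℓ} where

  Pointwise-∷ʳ : ∀ {s} {xs : Vec A s} {ys : Vec B s} {x y} →
                 Pointwise P xs ys → P x y → Pointwise P (xs ∷ʳ x) (ys ∷ʳ y)
  Pointwise-∷ʳ []       pxy = pxy ∷ []
  Pointwise-∷ʳ (p ∷ ps) pxy = p ∷ Pointwise-∷ʳ ps pxy

  Pointwise-last : ∀ {s} {xs : Vec A (suc s)} {ys : Vec B (suc s)} →
                   Pointwise P xs ys → P (last xs) (last ys)
  Pointwise-last (p ∷ [])         = p
  Pointwise-last (_ ∷ ps@(_ ∷ _)) = Pointwise-last ps

  Pointwise-map-lookup : ∀ {s l} {xs : Vec A s} {ys : Vec B s} → Pointwise P xs ys →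
                         (is : Vec (Fin s) l) → Pointwise P (map (lookup xs) is) (map (lookup ys) is)
  Pointwise-map-lookup ps []       = []
  Pointwise-map-lookup ps (i ∷ is) = Pointwise.lookup ps i ∷ Pointwise-map-lookup ps is

  Pointwise-mapˡ : ∀ {A′ : Set} {Q : REL A′ B 0ℓ} {f : A → A′} {s} {xs : Vec A s} {ys : Vec B s} →
                   (∀ {x y} → P x y → Q (f x) y) → Pointwise P xs ys → Pointwise Q (map f xs) ys
  Pointwise-mapˡ P⇒Q []       = []
  Pointwise-mapˡ P⇒Q (p ∷ ps) = P⇒Q p ∷ Pointwise-mapˡ P⇒Q ps

⋁ : ∀ {k} → (Fin k → Bool) → Bool
⋁ {zero}  p = false
⋁ {suc k} p = p zero ∨ ⋁ (p ∘ suc)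

⋁-cong : ∀ {k} {p q : Fin k → Bool} → (∀ c → p c ≡ q c) → ⋁ p ≡ ⋁ q
⋁-cong {zero}  p≗q = refl
⋁-cong {suc k} p≗q = cong₂ _∨_ (p≗q zero) (⋁-cong (p≗q ∘ suc))

⋁-intro : ∀ {k} (p : Fin k → Bool) c → p c ≡ true → ⋁ p ≡ true
⋁-intro p zero    pc = cong (_∨ ⋁ (p ∘ suc)) pc
⋁-intro p (suc c) pc = trans (cong (p zero ∨_) (⋁-intro (p ∘ suc) c pc)) (∨-zeroʳ (p zero))

⋁-elim : ∀ {k} (p : Fin k → Bool) → ⋁ p ≡ true → ∃[ c ] p c ≡ true
⋁-elim {suc k} p ⋁p with p zero in p₀
... | true  = zero , p₀
... | false with ⋁-elim (p ∘ suc) ⋁p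
...   | c , pc = suc c , pc

monotone-expansion : ∀ (g : Bool → Bool) → (g false ≡ true → g true ≡ true) →
                     ∀ β → g false ∨ (g true ∧ β) ≡ g β
monotone-expansion g mono false = trans (cong (g false ∨_) (∧-zeroʳ (g true))) (∨-identityʳ (g false))
monotone-expansion g mono true  = trans (cong (g false ∨_) (∧-identityʳ (g true))) absorb
  where
  absorb : g false ∨ g true ≡ g true
  absorb with g false
  ... | true  = sym (mono refl)
  ... | false = refl

data Connective : Set where
  conj disj : Connective

⟦_⟧ᶜ : Connective → Bool → Bool → Bool
⟦ conj ⟧ᶜ = _∧_
⟦ disj ⟧ᶜ = _∨_

gateOf : ∀ {n s} → Connective → Fin s → Fin s → MNode n s
gateOf conj = and
gateOf disj = or

evalMNode-gateOf : ∀ {n s} κ (p q : Fin s) (v : Vec Bool s) (b : Vec Bool n) →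
                   evalMNode (gateOf κ p q) v b ≡ ⟦ κ ⟧ᶜ (lookup v p) (lookup v q)
evalMNode-gateOf conj p q v b = refl
evalMNode-gateOf disj p q v b = refl

-- Monotone formulas over input bits whose atoms X stand for wires already present in a circuit.
data Formula (X : Set) (n : ℕ) : Set where
  atom    : X → Formula X n
  bit     : Fin n → Formula X n
  lit     : Bool → Formula X n
  connect : Connective → Formula X n → Formula X n → Formula X n

joinSize : ℕ → ℕ → ℕ
joinSize zero    g = 1
joinSize (suc k) g = suc (g + joinSize k g)

module _ {X : Set} {n : ℕ} where

  _∧ᶠ_ _∨ᶠ_ : Formula X n → Formula X n → Formula X n
  _∧ᶠ_ = connect conj
  _∨ᶠ_ = connect disj

  evalF : (X → Bool) → Vec Bool n → Formula X n → Bool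
  evalF env b (atom x)        = env x
  evalF env b (bit j)         = lookup b j
  evalF env b (lit β)         = β
  evalF env b (connect κ e f) = ⟦ κ ⟧ᶜ (evalF env b e) (evalF env b f)

  -- atoms are existing wires and need no new node
  nodeCount : Formula X n → ℕ
  nodeCount (atom x)        = 0
  nodeCount (bit j)         = 1
  nodeCount (lit β)         = 1
  nodeCount (connect κ e f) = suc (nodeCount e + nodeCount f)

  evalF-cong : ∀ {env env′ : X → Bool} → (∀ x → env x ≡ env′ x) →
               ∀ b e → evalF env b e ≡ evalF env′ b e
  evalF-cong env≗env′ b (atom x)        = env≗env′ x
  evalF-cong env≗env′ b (bit j)         = refl
  evalF-cong env≗env′ b (lit β)         = refl
  evalF-cong env≗env′ b (connect κ e f) =
    cong₂ ⟦ κ ⟧ᶜ (evalF-cong env≗env′ b e) (evalF-cong env≗env′ b f)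

  ⋁ᶠ : ∀ {k} → (Fin k → Formula X n) → Formula X n
  ⋁ᶠ {zero}  fs = lit false
  ⋁ᶠ {suc k} fs = fs zero ∨ᶠ ⋁ᶠ (fs ∘ suc)

  evalF-⋁ᶠ : ∀ env b {k} (fs : Fin k → Formula X n) → evalF env b (⋁ᶠ fs) ≡ ⋁ (evalF env b ∘ fs)
  evalF-⋁ᶠ env b {zero}  fs = refl
  evalF-⋁ᶠ env b {suc k} fs = cong (evalF env b (fs zero) ∨_) (evalF-⋁ᶠ env b (fs ∘ suc))

  ⋁ᶠ-nodeCount : ∀ {k} (fs : Fin k → Formula X n) {g} → (∀ c → nodeCount (fs c) ≡ g) →
                 nodeCount (⋁ᶠ fs) ≡ joinSize k g
  ⋁ᶠ-nodeCount {zero}  fs size≡g = refl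
  ⋁ᶠ-nodeCount {suc k} fs size≡g =
    cong suc (cong₂ _+_ (size≡g zero) (⋁ᶠ-nodeCount (fs ∘ suc) (size≡g ∘ suc)))

  unary : (Bool → Bool) → Fin n → Formula X n
  unary g j = lit (g false) ∨ᶠ (lit (g true) ∧ᶠ bit j)

  unary-correct : ∀ env b (g : Bool → Bool) j → (g false ≡ true → g true ≡ true) →
                  evalF env b (unary g j) ≡ g (lookup b j)
  unary-correct env b g j mono = monotone-expansion g mono (lookup b j)

-- Compiling formulas into monotone circuits

module _ {n : ℕ} where

  value : ∀ {s} → MCirc n s → Vec Bool n → Fin s → Bool
  value C b = lookup (evalMCirc C b)

  record Extension {s : ℕ} (C : MCirc n s) : Set where
    field
      {nodes}   : ℕ
      circuit   : MCirc n nodes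
      embed     : Fin s → Fin nodes
      preserves : ∀ b i → value circuit b (embed i) ≡ value C b i

  Extension-refl : ∀ {s} (C : MCirc n s) → Extension C
  Extension-refl C = record { circuit = C ; embed = id ; preserves = λ _ _ → refl }

  Extension-snoc : ∀ {s} (C : MCirc n s) (nd : MNode n s) → Extension C
  Extension-snoc C nd = record
    { circuit = C ▷ nd ; embed = inject₁ ; preserves = λ b → lookup-∷ʳ-inject₁ (evalMCirc C b) _ }

  _⨾_ : ∀ {s} {C : MCirc n s} (E : Extension C) → Extension (Extension.circuit E) → Extension C
  E ⨾ F = record
    { circuit   = F.circuit
    ; embed     = F.embed ∘ E.embed
    ; preserves = λ b i → trans (F.preserves b (E.embed i)) (E.preserves b i)
    }
    where
    module E = Extension E
    module F = Extension F

  evalF-embed : ∀ {X s} {C : MCirc n s} (E : Extension C) (σ : X → Fin s) b e →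
                evalF (value (Extension.circuit E) b ∘ Extension.embed E ∘ σ) b e ≡ evalF (value C b ∘ σ) b e
  evalF-embed E σ b = evalF-cong (λ x → Extension.preserves E b (σ x)) b

  record Realization {X : Set} {s : ℕ} (C : MCirc n s) (σ : X → Fin s) (e : Formula X n) : Set where
    field
      extension : Extension C
    open Extension extension public
    field
      wire     : Fin nodes
      computes : ∀ b → value circuit b wire ≡ evalF (value C b ∘ σ) b e
      nodes-≡  : nodes ≡ s + nodeCount e

  realizeBySnoc : ∀ {X s} {C : MCirc n s} {σ : X → Fin s} {e} (E : Extension C) →
                  let open Extension E in (nd : MNode n nodes) →
                  (∀ b → evalMNode nd (evalMCirc circuit b) b ≡ evalF (value C b ∘ σ) b e) →
                  suc nodes ≡ s + nodeCount e → Realization C σ e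
  realizeBySnoc E nd computes nodes-≡ = record
    { extension = E ⨾ Extension-snoc _ nd
    ; wire      = fromℕ _
    ; computes  = λ b → trans (lookup-∷ʳ-fromℕ (evalMCirc (Extension.circuit E) b) _) (computes b)
    ; nodes-≡   = nodes-≡
    }

  compile : ∀ {X s} (C : MCirc n s) (σ : X → Fin s) (e : Formula X n) → Realization C σ e
  compile {s = s} C σ (atom x) = record
    { extension = Extension-refl C ; wire = σ x ; computes = λ _ → refl ; nodes-≡ = sym (+-identityʳ s) }
  compile {s = s} C σ (bit j) = realizeBySnoc (Extension-refl C) (mvar j) (λ _ → refl) (+-comm 1 s)
  compile {s = s} C σ (lit β) = realizeBySnoc (Extension-refl C) (mconst β) (λ _ → refl) (+-comm 1 s)
  compile {s = s} C σ (connect κ e f) =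
    realizeBySnoc (Re.extension ⨾ Rf.extension) (gateOf κ (Rf.embed Re.wire) Rf.wire) computes nodes-≡
    where
    module Re = Realization (compile C σ e)
    module Rf = Realization (compile Re.circuit (Re.embed ∘ σ) f)
    computes : ∀ b → evalMNode (gateOf κ (Rf.embed Re.wire) Rf.wire) (evalMCirc Rf.circuit b) b
                       ≡ evalF (value C b ∘ σ) b (connect κ e f)
    computes b = begin
      evalMNode (gateOf κ (Rf.embed Re.wire) Rf.wire) (evalMCirc Rf.circuit b) b
        ≡⟨ evalMNode-gateOf κ _ _ _ b ⟩
      ⟦ κ ⟧ᶜ (value Rf.circuit b (Rf.embed Re.wire)) (value Rf.circuit b Rf.wire)
        ≡⟨ cong₂ ⟦ κ ⟧ᶜ (trans (Rf.preserves b Re.wire) (Re.computes b))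
                        (trans (Rf.computes b) (evalF-embed Re.extension σ b f)) ⟩
      ⟦ κ ⟧ᶜ (evalF (value C b ∘ σ) b e) (evalF (value C b ∘ σ) b f)
        ∎
      where open ≡-Reasoning
    nodes-≡ : suc Rf.nodes ≡ s + nodeCount (connect κ e f)
    nodes-≡ = begin
      suc Rf.nodes                          ≡⟨ cong suc Rf.nodes-≡ ⟩
      suc (Re.nodes + nodeCount f)          ≡⟨ cong (λ m → suc (m + nodeCount f)) Re.nodes-≡ ⟩
      suc (s + nodeCount e + nodeCount f)   ≡⟨ cong suc (+-assoc s (nodeCount e) (nodeCount f)) ⟩
      suc (s + (nodeCount e + nodeCount f)) ≡⟨ +-suc s _ ⟨
      s + suc (nodeCount e + nodeCount f)   ∎
      where open ≡-Reasoning

  record Realizations {X : Set} {s l : ℕ} (C : MCirc n s) (σ : X → Fin s) (es : Fin l → Formula X n) : Set where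
    field
      extension : Extension C
    open Extension extension public
    field
      wires    : Fin l → Fin nodes
      computes : ∀ b i → value circuit b (wires i) ≡ evalF (value C b ∘ σ) b (es i)

  compileAll : ∀ {X s l} (C : MCirc n s) (σ : X → Fin s) (es : Fin l → Formula X n) → Realizations C σ es
  compileAll {l = zero}  C σ es = record { extension = Extension-refl C ; wires = λ () ; computes = λ _ () }
  compileAll {l = suc l} C σ es = record
    { extension = R.extension ⨾ Rs.extension
    ; wires     = wires
    ; computes  = computes
    }
    where
    module R  = Realization (compile C σ (es zero))
    module Rs = Realizations (compileAll R.circuit (R.embed ∘ σ) (es ∘ suc))
    wires : Fin (suc l) → Fin Rs.nodes
    wires zero    = Rs.embed R.wire
    wires (suc i) = Rs.wires i
    computes : ∀ b i → value Rs.circuit b (wires i) ≡ evalF (value C b ∘ σ) b (es i)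
    computes b zero    = trans (Rs.preserves b R.wire) (R.computes b)
    computes b (suc i) = trans (Rs.computes b i) (evalF-embed R.extension σ b (es (suc i)))

  compileAll-nodes : ∀ {X s l} (C : MCirc n s) (σ : X → Fin s) (es : Fin l → Formula X n) {B} →
                     (∀ i → nodeCount (es i) ≤ B) →
                     Extension.nodes (Realizations.extension (compileAll C σ es)) ≤ s + l * B
  compileAll-nodes {s = s} {zero}  C σ es     bounded = m≤m+n s 0
  compileAll-nodes {s = s} {suc l} C σ es {B} bounded = begin
    Rs.nodes                        ≤⟨ compileAll-nodes R.circuit (R.embed ∘ σ) (es ∘ suc) (bounded ∘ suc) ⟩
    R.nodes + l * B                 ≡⟨ cong (_+ l * B) R.nodes-≡ ⟩
    s + nodeCount (es zero) + l * B ≤⟨ +-monoˡ-≤ (l * B) (+-monoʳ-≤ s (bounded zero)) ⟩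
    s + B + l * B                   ≡⟨ +-assoc s B (l * B) ⟩
    s + suc l * B                   ∎
    where
    open ≤-Reasoning
    module R  = Realization (compile C σ (es zero))
    module Rs = Realizations (compileAll R.circuit (R.embed ∘ σ) (es ∘ suc))

-- Threshold encoding in a finite total order

module Thresholds {k : ℕ} {_≼_ : Rel (Fin k) 0ℓ} (≼-isTotalOrder : IsTotalOrder _≡_ _≼_) where
  open IsTotalOrder ≼-isTotalOrder
    using (reflexive; antisym; total) renaming (refl to ≼-refl; trans to ≼-trans)

  _≼?_ : Decidable _≼_
  _≼?_ = total∧dec⇒dec reflexive antisym total _≟_

  ⟦_≼_⟧ : Fin k → Fin k → Bool
  ⟦ a ≼ x ⟧ = does (a ≼? x)

  ⟦≼⟧-complete : ∀ {a x} → a ≼ x → ⟦ a ≼ x ⟧ ≡ true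
  ⟦≼⟧-complete {a} {x} = dec-true (a ≼? x)

  ⟦≼⟧-sound : ∀ {a x} → ⟦ a ≼ x ⟧ ≡ true → a ≼ x
  ⟦≼⟧-sound {a} {x} ⟦a≼x⟧ with a ≼? x
  ... | yes a≼x = a≼x

  ⟦≼⟧-mono : ∀ {a x y} → x ≼ y → ⟦ a ≼ x ⟧ ≡ true → ⟦ a ≼ y ⟧ ≡ true
  ⟦≼⟧-mono x≼y a≼x = ⟦≼⟧-complete (≼-trans (⟦≼⟧-sound a≼x) x≼y)

  ⋁-upset : ∀ (h : Fin k → Bool) → (∀ {c x} → c ≼ x → h c ≡ true → h x ≡ true) →
            ∀ x → ⋁ (λ c → ⟦ c ≼ x ⟧ ∧ h c) ≡ h x
  ⋁-upset h upward x with h x in hx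
  ... | true  = ⋁-intro _ x (cong₂ _∧_ (⟦≼⟧-complete ≼-refl) hx)
  ... | false = ¬-not λ ⋁≡true → false≢true (witness⇒h[x] (⋁-elim _ ⋁≡true))
    where
    witness⇒h[x] : ∃[ c ] ⟦ c ≼ x ⟧ ∧ h c ≡ true → false ≡ true
    witness⇒h[x] (c , p) = trans (sym hx) (upward (⟦≼⟧-sound (∧-conicalˡ _ _ p)) (∧-conicalʳ _ _ p))
    false≢true : false ≢ true
    false≢true ()

  code : Fin k → Vec Bool k
  code x = tabulate λ a → ⟦ a ≼ x ⟧

  code-injective : ∀ {x y} → code x ≡ code y → x ≡ y
  code-injective eq = antisym (≼-from eq) (≼-from (sym eq))
    where
    open ≡-Reasoning
    ≼-from : ∀ {x y} → code x ≡ code y → x ≼ y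
    ≼-from {x} {y} eq = ⟦≼⟧-sound (begin
      ⟦ x ≼ y ⟧         ≡⟨ lookup∘tabulate _ x ⟨
      lookup (code y) x ≡⟨ cong (λ v → lookup v x) eq ⟨
      lookup (code x) x ≡⟨ lookup∘tabulate _ x ⟩
      ⟦ x ≼ x ⟧         ≡⟨ ⟦≼⟧-complete ≼-refl ⟩
      true              ∎)

  decode : (Fin k → Bool) → Vec Bool k → Bool
  decode S v with any? (λ x → ≡-dec Bool._≟_ (code x) v)
  ... | yes (x , _) = S x
  ... | no _        = false

  decode-code : ∀ S x → decode S (code x) ≡ S x
  decode-code S x with any? (λ y → ≡-dec Bool._≟_ (code y) (code x))
  ... | yes (y , eq) = cong S (code-injective eq)
  ... | no ∄y        = ⊥-elim (∄y (x , refl))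

  Encodes : ∀ {Y : Set} → (Y → Bool) → (Fin k → Y) → Fin k → Set
  Encodes env w x = ∀ a → env (w a) ≡ ⟦ a ≼ x ⟧

  Monotone : ∀ {r} → (Vec (Fin k) r → Bool) → Set
  Monotone f = ∀ {t t′} → Pointwise _≼_ t t′ → f t ≡ true → f t′ ≡ true

  -- ⋁_{c₁} ([c₁ ≼ x₁] ∧ ⋁_{c₂} ([c₂ ≼ x₂] ∧ … f(c₁,…,c_r))), equal to f(x₁,…,x_r) for monotone f.
  gadget : ∀ {X n} r → (Vec (Fin k) r → Bool) → Vec (Fin k → X) r → Formula X n
  gadget zero    f []       = lit (f [])
  gadget (suc r) f (w ∷ ws) = ⋁ᶠ λ c → atom (w c) ∧ᶠ gadget r (λ t → f (c ∷ t)) ws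

  gadgetSize : ℕ → ℕ
  gadgetSize zero    = 1
  gadgetSize (suc r) = joinSize k (suc (gadgetSize r))

  gadget-nodeCount : ∀ {X n} r f (ws : Vec (Fin k → X) r) → nodeCount {n = n} (gadget r f ws) ≡ gadgetSize r
  gadget-nodeCount zero    f []       = refl
  gadget-nodeCount (suc r) f (w ∷ ws) =
    ⋁ᶠ-nodeCount _ (λ c → cong suc (gadget-nodeCount r (λ t → f (c ∷ t)) ws))

  gadget-correct : ∀ {X n} (env : X → Bool) (b : Vec Bool n) {r f} {ws : Vec (Fin k → X) r} {xs} →
                   Monotone f → Pointwise (Encodes env) ws xs → evalF env b (gadget r f ws) ≡ f xs
  gadget-correct env b mono [] = refl
  gadget-correct env b {suc r} {f} {w ∷ ws} {x ∷ xs} mono (w≈x ∷ ws≈xs) = begin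
    evalF env b (gadget (suc r) f (w ∷ ws))
      ≡⟨ evalF-⋁ᶠ env b (λ c → atom (w c) ∧ᶠ gadget r (λ t → f (c ∷ t)) ws) ⟩
    ⋁ (λ c → env (w c) ∧ evalF env b (gadget r (λ t → f (c ∷ t)) ws))
      ≡⟨ ⋁-cong (λ c → cong₂ _∧_ (w≈x c) (gadget-correct env b (mono ∘ (≼-refl ∷_)) ws≈xs)) ⟩
    ⋁ (λ c → ⟦ c ≼ x ⟧ ∧ f (c ∷ xs))
      ≡⟨ ⋁-upset (λ c → f (c ∷ xs)) (λ c≼x → mono (c≼x ∷ Pointwise.refl ≼-refl)) x ⟩
    f (x ∷ xs)
      ∎
    where open ≡-Reasoning

module _ (𝔸 : FinAlgebra) where
  open FinAlgebra 𝔸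

  evalTs-map-var : ∀ {n l} (js : Vec (Fin n) l) (x : Vec Carrier n) →
                   evalTs 𝔸 (map var js) x ≡ map (lookup x) js
  evalTs-map-var []       x = refl
  evalTs-map-var (j ∷ js) x = cong (lookup x j ∷_) (evalTs-map-var js x)

  op-monotone : ∀ {R : Rel Carrier 0ℓ} → PreservedByPolynomials 𝔸 R →
                ∀ i {t t′} → Pointwise R t t′ → R (op i t) (op i t′)
  op-monotone {R} preserved i {t} {t′} t≤t′ =
    subst₂ R (evalT-op t) (evalT-op t′) (preserved (ar i) (app i (map var (allFin (ar i)))) t t′ t≤t′)
    where
    evalT-op : ∀ x → evalT 𝔸 (app i (map var (allFin (ar i)))) x ≡ op i x
    evalT-op x = cong (op i) (trans (evalTs-map-var (allFin (ar i)) x) (map-lookup-allFin x))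

  PreservedByPolynomials-flip : ∀ {R : Rel Carrier 0ℓ} →
                                PreservedByPolynomials 𝔸 R → PreservedByPolynomials 𝔸 (flip R)
  PreservedByPolynomials-flip preserved n t x y x≥y = preserved n t y x (Pointwise.sym id x≥y)

  orientedOrder : TotallyOrdered 𝔸 → (x y : Carrier) →
                  Σ (Rel Carrier 0ℓ) λ R → IsTotalOrder _≡_ R × PreservedByPolynomials 𝔸 R × R x y
  orientedOrder (R , isTotalOrder , preserved) x y with IsTotalOrder.total isTotalOrder x y
  ... | inj₁ x≤y = R , isTotalOrder , preserved , x≤y
  ... | inj₂ y≤x = flip R , Flip.isTotalOrder isTotalOrder , PreservedByPolynomials-flip preserved , y≤x

-- Threshold circuits for circuits over a totally ordered algebra

module ThresholdCircuits (𝔸 : FinAlgebra) {_≼_ : Rel (FinAlgebra.Carrier 𝔸) 0ℓ}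
         (≼-isTotalOrder : IsTotalOrder _≡_ _≼_)
         (op-mono : ∀ i {t t′} → Pointwise _≼_ t t′ → _≼_ (FinAlgebra.op 𝔸 i t) (FinAlgebra.op 𝔸 i t′))
         (ι : Bool → FinAlgebra.Carrier 𝔸) (ι-mono : ι false ≼ ι true) where
  open FinAlgebra 𝔸
  open Thresholds ≼-isTotalOrder

  nodeFormulas : ∀ {X n s} → Node 𝔸 n s → Vec (Fin k → X) s → Fin k → Formula X n
  nodeFormulas (input j)   ws a = unary (λ β → ⟦ a ≼ ι β ⟧) j
  nodeFormulas (cnst c)    ws a = lit ⟦ a ≼ c ⟧
  nodeFormulas (gate i js) ws a = gadget (ar i) (λ t → ⟦ a ≼ op i t ⟧) (map (lookup ws) js)

  gadgetSizes : List.List ℕ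
  gadgetSizes = List.map (gadgetSize ∘ ar) (List.allFin m)

  -- 5 is the node count of the formula of an input node.
  nodeBound : ℕ
  nodeBound = max 5 gadgetSizes

  nodeFormulas-nodeCount : ∀ {X n s} (nd : Node 𝔸 n s) (ws : Vec (Fin k → X) s) a →
                           nodeCount (nodeFormulas nd ws a) ≤ nodeBound
  nodeFormulas-nodeCount (input j)   ws a = ⊥≤max 5 gadgetSizes
  nodeFormulas-nodeCount (cnst c)    ws a = ≤-trans (s≤s z≤n) (⊥≤max 5 gadgetSizes)
  nodeFormulas-nodeCount (gate i js) ws a = begin
    nodeCount (gadget (ar i) _ (map (lookup ws) js)) ≡⟨ gadget-nodeCount (ar i) _ _ ⟩
    gadgetSize (ar i)                                ≤⟨ v≤max⁺ 5 gadgetSizes (inj₂ i∈ops) ⟩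
    nodeBound                                        ∎
    where
    open ≤-Reasoning
    i∈ops = Any.map ≤-reflexive (∈-map⁺ (gadgetSize ∘ ar) (∈-allFin i))

  nodeFormulas-correct : ∀ {X n s} (env : X → Bool) (b : Vec Bool n) (nd : Node 𝔸 n s) {ws vs} →
                         Pointwise (Encodes env) ws vs →
                         Encodes (evalF env b) (nodeFormulas nd ws) (evalNode 𝔸 nd vs (map ι b))
  nodeFormulas-correct env b (input j) ws≈vs a = begin
    evalF env b (unary (λ β → ⟦ a ≼ ι β ⟧) j)
      ≡⟨ unary-correct env b (λ β → ⟦ a ≼ ι β ⟧) j (⟦≼⟧-mono ι-mono) ⟩
    ⟦ a ≼ ι (lookup b j) ⟧                   ≡⟨ cong ⟦ a ≼_⟧ (lookup-map j ι b) ⟨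
    ⟦ a ≼ lookup (map ι b) j ⟧               ∎
    where open ≡-Reasoning
  nodeFormulas-correct env b (cnst c) ws≈vs a = refl
  nodeFormulas-correct env b (gate i js) ws≈vs a =
    gadget-correct env b (⟦≼⟧-mono ∘ op-mono i) (Pointwise-map-lookup ws≈vs js)

  record Encoding {n S : ℕ} (c : Circ 𝔸 n S) : Set where
    field
      {nodes}  : ℕ
      circuit  : MCirc n nodes
      wires    : Vec (Fin k → Fin nodes) S
      encodes  : ∀ b → Pointwise (Encodes (value circuit b)) wires (evalCirc 𝔸 c (map ι b))
      nodes-≤  : nodes ≤ S * (k * nodeBound)

  encode : ∀ {n S} (c : Circ 𝔸 n S) → Encoding c
  encode []       = record { circuit = [] ; wires = [] ; encodes = λ _ → [] ; nodes-≤ = z≤n }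
  encode {n} {suc S} (c ▷ nd) = record
    { circuit = R.circuit
    ; wires   = map (R.embed ∘_) E.wires ∷ʳ R.wires
    ; encodes = λ b → Pointwise-∷ʳ (Pointwise-mapˡ (old-wires b) (E.encodes b)) (new-wires b)
    ; nodes-≤ = begin
        R.nodes                             ≤⟨ compileAll-nodes E.circuit id formulas (nodeFormulas-nodeCount nd E.wires) ⟩
        E.nodes + k * nodeBound             ≤⟨ +-monoˡ-≤ (k * nodeBound) E.nodes-≤ ⟩
        S * (k * nodeBound) + k * nodeBound ≡⟨ +-comm (S * (k * nodeBound)) (k * nodeBound) ⟩
        suc S * (k * nodeBound)             ∎
    }
    where
    open ≤-Reasoning
    module E = Encoding (encode c)
    formulas : Fin k → Formula (Fin E.nodes) n
    formulas = nodeFormulas nd E.wires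
    module R = Realizations (compileAll E.circuit id formulas)
    old-wires : ∀ b {w x} → Encodes (value E.circuit b) w x → Encodes (value R.circuit b) (R.embed ∘ w) x
    old-wires b {w} w≈x a = trans (R.preserves b (w a)) (w≈x a)
    new-wires : ∀ b → Encodes (value R.circuit b) R.wires (evalNode 𝔸 nd (evalCirc 𝔸 c (map ι b)) (map ι b))
    new-wires b a = trans (R.computes b a) (nodeFormulas-correct (value E.circuit b) b nd (E.encodes b) a)

  -- A monotone circuit outputs its last node, so the threshold wire is copied to the end.
  thresholdCircuit : ∀ {n S} (c : Circ 𝔸 n (suc S)) → Fin k → MCirc n (suc (Encoding.nodes (encode c)))
  thresholdCircuit c a = circuit ▷ or (last wires a) (last wires a)
    where open Encoding (encode c)

  thresholdCircuit-correct : ∀ {n S} (c : Circ 𝔸 n (suc S)) a b →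
                             moutput (thresholdCircuit c a) b ≡ ⟦ a ≼ output 𝔸 c (map ι b) ⟧
  thresholdCircuit-correct c a b = begin
    last (evalMCirc circuit b ∷ʳ (v ∨ v)) ≡⟨ last-∷ʳ (v ∨ v) (evalMCirc circuit b) ⟩
    v ∨ v                                 ≡⟨ ∨-idem v ⟩
    v                                     ≡⟨ Pointwise-last (encodes b) a ⟩
    ⟦ a ≼ output 𝔸 c (map ι b) ⟧          ∎
    where
    open ≡-Reasoning
    open Encoding (encode c)
    v = value circuit b (last wires a)

PolyBounded-≤ : ∀ {f g} → PolyBounded f → (∀ n → g n ≤ f n) → PolyBounded g
PolyBounded-≤ (c , d , f≤) g≤f = c , d , λ n → ≤-trans (g≤f n) (f≤ n)

PolyBounded-suc-* : ∀ {f} → PolyBounded f → ∀ K → PolyBounded (λ n → suc (f n) * K)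
PolyBounded-suc-* {f} (c , d , f≤) K = suc c * K , d , bound
  where
  open ≤-Reasoning
  bound : ∀ n → suc (f n) * K ≤ suc c * K * suc n ^ d
  bound n = begin
    suc (f n) * K         ≤⟨ *-monoˡ-≤ K (s≤s (f≤ n)) ⟩
    suc (c * x) * K       ≤⟨ *-monoˡ-≤ K (+-monoˡ-≤ (c * x) (m^n>0 (suc n) d)) ⟩
    suc c * x * K         ≡⟨ *-assoc (suc c) x K ⟩
    suc c * (x * K)       ≡⟨ cong (suc c *_) (*-comm x K) ⟩
    suc c * (K * x)       ≡⟨ *-assoc (suc c) K x ⟨
    suc c * K * x         ∎
    where x = suc n ^ d

mainTheorem12 : (𝔸 : FinAlgebra) → TotallyOrdered 𝔸 →
    (L : Lang) → nuP 𝔸 L → MULTIMONOTONE L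
mainTheorem12 𝔸 ordered L (D , L≡D)
  with orientedOrder 𝔸 ordered (NuDFA.ι D false) (NuDFA.ι D true)
... | _ , ≼-isTotalOrder , preserved , ι-mono =
  k , decode S , (λ _ n → Encoding.nodes (encode (t n))) , (λ a n → thresholdCircuit (t n) a) ,
  (λ _ → PolyBounded-≤ (PolyBounded-suc-* poly (k * nodeBound)) (Encoding.nodes-≤ ∘ encode ∘ t)) ,
  correct
  where
  open FinAlgebra 𝔸
  open NuDFA D
  open ThresholdCircuits 𝔸 ≼-isTotalOrder (op-monotone 𝔸 preserved) ι ι-mono
  open Thresholds ≼-isTotalOrder
  correct : ∀ n b → L n b ≡ decode S (tabulate λ a → moutput (thresholdCircuit (t n) a) b)
  correct n b = begin
    L n b
      ≡⟨ L≡D n b ⟩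
    S (output 𝔸 (t n) (map ι b))
      ≡⟨ decode-code S _ ⟨
    decode S (code (output 𝔸 (t n) (map ι b)))
      ≡⟨ cong (decode S) (tabulate-cong λ a → sym (thresholdCircuit-correct (t n) a b)) ⟩
    decode S (tabulate λ a → moutput (thresholdCircuit (t n) a) b)
      ∎
    where open ≡-Reasoning
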